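{- Let $n\ge3$. Then $\mathrm{hypo}(\mathcal{C}_n)$ does not satisfy any nontrivial identity.
   Context: Let $C_n=\{1<2<\cdots<n<\bar n<\overline{n-1}<\cdots<\bar 1\}$; $C_n^*$ is the free monoid of words over $C_n$ and $|w|_a$ the number of occurrences of the letter $a$ in $w$. Convention: the symbols $n+1$ and $\overline{n+1}$ never occur in any word. For $i\in\{1,\dots,n\}$, $w$ has an $i$-inversion if $w=w_1xw_2yw_3$ with $x\in\{i,\overline{i+1}\}$, $y\in\{i+1,\bar i\}$. Quasi-crystal structure on $C_n^*$: $\mathrm{wt}(w)=(|w|_1-|w|_{\bar1},\dots,|w|_n-|w|_{\bar n})\in\mathbb{Z}^n$. For $i\in\{1,\dots,n\}$: if $w$ has an $i$-inversion then $\ddot{\varepsilon}_i(w)=\ddot{\varphi}_i(w)=+\infty$ and $\ddot{e}_i(w),\ddot{f}_i(w)$ are undefined; otherwise $\ddot{\varepsilon}_i(w)=|w|_{i+1}+|w|_{\bar i}$, $\ddot{\varphi}_i(w)=|w|_i+|w|_{\overline{i+1}}$; $\ddot{e}_i(w)$ is defined iff $\ddot{\varepsilon}_i(w)>0$ and is obtained by replacing the right-most letter of $w$ lying in $\{i+1,\bar i\}$ by its image ($i+1\mapsto i$, $\bar i\mapsto\overline{i+1}$ for $i<n$; $\bar n\mapsto n$ for $i=n$); $\ddot{f}_i(w)$ is defined iff $\ddot{\varphi}_i(w)>0$ and is obtained by replacing the left-most letter of $w$ lying in $\{i,\overline{i+1}\}$ by its image ($i\mapsto i+1$, $\overline{i+1}\mapsto\bar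 i$ for $i<n$; $n\mapsto\bar n$ for $i=n$). The connected component $C_n^*(w)$ is the set of words obtained from $w$ by finitely many (defined) applications of the operators $\ddot{e}_i,\ddot{f}_i$. Hypoplactic congruence: $u\ddot{\sim}v$ iff there is a bijection $\psi:C_n^*(u)\to C_n^*(v)$ with $\psi(u)=v$ such that for all $x\in C_n^*(u)$ and $i$: $\psi(x)$ has the same $\mathrm{wt},\ddot{\varepsilon}_i,\ddot{\varphi}_i$ as $x$, $\ddot{e}_i(\psi(x))$ is defined iff $\ddot{e}_i(x)$ is (and then $\psi(\ddot{e}_i(x))=\ddot{e}_i(\psi(x))$), and likewise for $\ddot{f}_i$. It is a monoid congruence and $\mathrm{hypo}(\mathcal{C}_n)=C_n^*/\ddot{\sim}$. A monoid $M$ satisfies an identity $u=v$ (with $u,v\in X^*$, $X$ a finite alphabet) if $\phi(u)=\phi(v)$ for every monoid homomorphism $\phi:X^*\to M$; the identity is nontrivial if $u\ne v$ as words. -}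

module Defs where

open import Data.Nat using (ℕ; zero; suc; _<_; _<?_)
open import Data.Nat.Properties using ()
open import Data.Fin using (Fin; zero; suc; toℕ; fromℕ<; inject₁)
open import Data.Integer using (ℤ; _-_; +_)
open import Data.Bool using (Bool; true; false; _∧_; _∨_; if_then_else_)
open import Data.List using (List; []; _∷_; _++_; reverse; concatMap)
open import Data.Bool.ListAction using (any)
open import Data.Maybe using (Maybe; just; nothing)
import Data.Maybe as Maybe
open import Data.Product using (Σ; ∃; _×_; _,_)
open import Relation.Nullary using (yes; no; ¬_)
open import Relation.Nullary.Decidable using (⌊_⌋)
open import Relation.Binary.PropositionalEquality using (_≡_)
import Data.Nat as ℕ

-- The alphabet C_n.  pos j  is the letter (toℕ j + 1),
-- neg j  is the letter  bar(toℕ j + 1).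
data Letter (n : ℕ) : Set where
  pos : Fin n → Letter n
  neg : Fin n → Letter n

Word : ℕ → Set
Word n = List (Letter n)

-- Indices i ∈ {1,…,n} are represented by Fin n (i = toℕ i + 1).

isX : ∀ {n} → Fin n → Letter n → Bool
isX i (pos j) = ⌊ toℕ j ℕ.≟ toℕ i ⌋
isX i (neg j) = ⌊ toℕ j ℕ.≟ suc (toℕ i) ⌋

isY : ∀ {n} → Fin n → Letter n → Bool
isY i (pos j) = ⌊ toℕ j ℕ.≟ suc (toℕ i) ⌋
isY i (neg j) = ⌊ toℕ j ℕ.≟ toℕ i ⌋

fImg : ∀ {n} → Letter n → Letter n
fImg {n} (pos j) with suc (toℕ j) <? n
... | yes p = pos (fromℕ< p)
... | no _  = neg j
fImg (neg zero)    = neg zero      -- never used (not in {i, bar(i+1)})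
fImg (neg (suc j)) = neg (inject₁ j)

eImg : ∀ {n} → Letter n → Letter n
eImg (pos zero)    = pos zero      -- never used (not in {i+1, bar i})
eImg (pos (suc j)) = pos (inject₁ j)
eImg {n} (neg j) with suc (toℕ j) <? n
... | yes p = neg (fromℕ< p)
... | no _  = pos j

count : ∀ {A : Set} → (A → Bool) → List A → ℕ
count p []      = 0
count p (a ∷ w) = if p a then suc (count p w) else count p w

hasInv : ∀ {n} → Fin n → Word n → Bool
hasInv i []      = false
hasInv i (a ∷ w) = (isX i a ∧ any (isY i) w) ∨ hasInv i w

isPos isNeg : ∀ {n} → Fin n → Letter n → Bool
isPos j (pos k) = ⌊ toℕ k ℕ.≟ toℕ j ⌋
isPos j (neg k) = false
isNeg j (pos k) = false
isNeg j (neg k) = ⌊ toℕ k ℕ.≟ toℕ j ⌋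

wt : ∀ {n} → Word n → Fin n → ℤ
wt w j = + count (isPos j) w - + count (isNeg j) w

data ℕ∞ : Set where
  fin : ℕ → ℕ∞
  ∞   : ℕ∞

ε̈ φ̈ : ∀ {n} → Fin n → Word n → ℕ∞
ε̈ i w = if hasInv i w then ∞ else fin (count (isY i) w)
φ̈ i w = if hasInv i w then ∞ else fin (count (isX i) w)

replaceFirst : ∀ {A : Set} → (A → Bool) → (A → A) → List A → Maybe (List A)
replaceFirst p g []      = nothing
replaceFirst p g (a ∷ w) =
  if p a then just (g a ∷ w) else Maybe.map (a ∷_) (replaceFirst p g w)

replaceLast : ∀ {A : Set} → (A → Bool) → (A → A) → List A → Maybe (List A)
replaceLast p g w = Maybe.map reverse (replaceFirst p g (reverse w))

ë f̈ : ∀ {n} → Fin n → Word n → Maybe (Word n)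
ë i w = if hasInv i w then nothing else replaceLast (isY i) eImg w
f̈ i w = if hasInv i w then nothing else replaceFirst (isX i) fImg w

data Reach {n : ℕ} (u : Word n) : Word n → Set where
  here  : Reach u u
  stepE : ∀ {x y} (i : Fin n) → Reach u x → ë i x ≡ just y → Reach u y
  stepF : ∀ {x y} (i : Fin n) → Reach u x → f̈ i x ≡ just y → Reach u y

-- hypoplactic congruence u ~ v: a bijection ψ : C_n^*(u) → C_n^*(v)
-- (given as a function on words restricted to the component) with ψ u = v
-- preserving wt, ε̈_i, φ̈_i, and commuting with ë_i, f̈_i
-- (Maybe.map ψ (ë i x) ≡ ë i (ψ x) says: defined iff defined, and commute).
HypoEq : ∀ {n} → Word n → Word n → Set
HypoEq {n} u v =
  Σ (Word n → Word n) λ ψ →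
      (ψ u ≡ v)
    × (∀ x → Reach u x → Reach v (ψ x))
    × (∀ x y → Reach u x → Reach u y → ψ x ≡ ψ y → x ≡ y)
    × (∀ y → Reach v y → ∃ λ x → Reach u x × ψ x ≡ y)
    × (∀ x → Reach u x →
          (∀ j → wt (ψ x) j ≡ wt x j)
        × (∀ i → ε̈ i (ψ x) ≡ ε̈ i x)
        × (∀ i → φ̈ i (ψ x) ≡ φ̈ i x)
        × (∀ i → Maybe.map ψ (ë i x) ≡ ë i (ψ x))
        × (∀ i → Maybe.map ψ (f̈ i x) ≡ f̈ i (ψ x)))

substWord : ∀ {n m} → (Fin m → Word n) → List (Fin m) → Word n
substWord σ = concatMap σ

-- hypo(C_n) satisfies the identity u = v (X = Fin m): every homomorphism
-- X^* → hypo(C_n), i.e. every assignment of a class [σ x] to each letter,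
-- identifies u and v.
Satisfies : ℕ → (m : ℕ) → List (Fin m) → List (Fin m) → Set
Satisfies n m u v = ∀ (σ : Fin m → Word n) → HypoEq (substWord σ u) (substWord σ v)

-- If |u| ≠ |v|, sending every variable to bar 2 separates them by
-- weight.  Otherwise u = p x u′ and v = p y v′ with x ≠ y; send x to 1 and every
-- other variable to bar 2, giving words s = σ(p) 1 σ(u′) and t = σ(p) bar 2 σ(v′).
-- A hypoplactic equivalence ψ with ψ s = t preserves weight, so σ(u′) contains
-- exactly one more bar 2 than σ(v′), and ψ commutes with every path of crystal
-- operators.  Apply ë₂ as often as σ(v′) has letters bar 2: this turns all of them
-- into bar 3 in t, but leaves one bar 2 in the tail of s.  Then apply f̈₁ to the
-- first |p| + 1 letters, which turns the 1 of s into a 2.  The image of s now has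
-- a 2 before a bar 2, i.e. a 2-inversion, so ε̈₂ = ∞; the image of t has no
-- letter 3 or bar 2, so ε̈₂ is finite — contradicting that ψ preserves ε̈₂.
module Submission where

open import Defs
open import Data.Nat using (ℕ; zero; suc; _+_; _≤_; s≤s)
open import Data.Nat.Properties using (suc-injective; +-cancelˡ-≡)
open import Data.Fin using (Fin; zero; suc; _≟_)
open import Data.List using (List; []; _∷_; _++_; _∷ʳ_; [_]; map; length; replicate; reverse)
open import Data.List.Properties
  using (map-++; map-∘; ++-assoc; ∷ʳ-++; reverse-++; unfold-reverse; reverse-involutive; concatMap-map; concatMap-pure)
open import Data.List.Relation.Unary.All using (All; []; _∷_; universal)
open import Data.List.Relation.Unary.All.Properties using (++⁺; map⁺)
open import Data.Bool using (Bool; true; false; not)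
open import Data.Bool.Properties using (∨-zeroʳ; ∧-zeroʳ)
open import Data.Bool.ListAction using (any)
open import Data.Maybe using (Maybe; just; nothing; _>>=_)
import Data.Maybe as Maybe
open import Data.Maybe.Properties using (just-injective)
open import Data.Product using (∃-syntax; _×_; _,_; proj₁; proj₂)
open import Data.Sum using (_⊎_; inj₁; inj₂)
open import Data.Integer using (+_; -_; _-_)
import Data.Integer.Properties as ℤ
open import Relation.Nullary using (¬_; yes; no; does)
open import Relation.Nullary.Decidable using (dec-true; dec-false)
open import Relation.Binary.Definitions using (DecidableEquality)
open import Relation.Binary.PropositionalEquality
  using (_≡_; _≢_; refl; sym; trans; cong; cong₂; subst; subst₂; module ≡-Reasoning)
open ≡-Reasoning

private
  variable
    A B : Set

Avoids : (A → Bool) → List A → Set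
Avoids p = All (λ x → p x ≡ false)

avoids-map-Bool : {p : A → Bool} {f : Bool → A} →
                  p (f true) ≡ false → p (f false) ≡ false → ∀ xs → Avoids p (map f xs)
avoids-map-Bool {p = p} {f} pt pf xs = map⁺ (universal cases xs)
  where
  cases : ∀ c → p (f c) ≡ false
  cases true  = pt
  cases false = pf

avoids-reverse : {p : A → Bool} (xs : List A) → Avoids p xs → Avoids p (reverse xs)
avoids-reverse []       []         = []
avoids-reverse (x ∷ xs) (px ∷ pxs) =
  subst (Avoids _) (sym (unfold-reverse x xs)) (++⁺ (avoids-reverse xs pxs) (px ∷ []))

any-avoids : (p : A → Bool) (xs : List A) → Avoids p xs → any p xs ≡ false
any-avoids p []       []        = refl
any-avoids p (x ∷ xs) (px ∷ ps) rewrite px = any-avoids p xs ps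

any-hit : (p : A → Bool) (xs : List A) {x : A} (ys : List A) →
          p x ≡ true → any p (xs ++ x ∷ ys) ≡ true
any-hit p []       ys px rewrite px = refl
any-hit p (z ∷ xs) ys px rewrite any-hit p xs ys px = ∨-zeroʳ (p z)

reverse-middle : (xs : List A) (x : A) (ys : List A) →
                 reverse (xs ++ x ∷ ys) ≡ reverse ys ++ x ∷ reverse xs
reverse-middle xs x ys = begin
  reverse (xs ++ x ∷ ys)           ≡⟨ reverse-++ xs (x ∷ ys) ⟩
  reverse (x ∷ ys) ++ reverse xs   ≡⟨ cong (_++ reverse xs) (unfold-reverse x ys) ⟩
  (reverse ys ∷ʳ x) ++ reverse xs  ≡⟨ ∷ʳ-++ (reverse ys) x (reverse xs) ⟩
  reverse ys ++ x ∷ reverse xs     ∎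

++-∷-∷ʳ : (xs : List A) (x : A) (ys : List A) (y : A) (zs : List A) →
          (xs ++ x ∷ ys ∷ʳ y) ++ zs ≡ xs ++ x ∷ ys ++ y ∷ zs
++-∷-∷ʳ xs x ys y zs = trans (++-assoc xs (x ∷ ys ∷ʳ y) zs) (cong (λ w → xs ++ x ∷ w) (∷ʳ-++ ys y zs))

map-∷ʳ-++ : (f : A → B) (xs : List A) (x : A) (ys : List B) →
            map f (xs ∷ʳ x) ++ ys ≡ map f xs ++ f x ∷ ys
map-∷ʳ-++ f xs x ys = trans (cong (_++ ys) (map-++ f xs [ x ])) (∷ʳ-++ (map f xs) (f x) ys)

replaceFirst-hit : (p : A → Bool) (g : A → A) (xs : List A) {x : A} (ys : List A) →
                   Avoids p xs → p x ≡ true → replaceFirst p g (xs ++ x ∷ ys) ≡ just (xs ++ g x ∷ ys)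
replaceFirst-hit p g []       ys []        px rewrite px = refl
replaceFirst-hit p g (z ∷ xs) ys (pz ∷ ps) px rewrite pz | replaceFirst-hit p g xs ys ps px = refl

replaceLast-hit : (p : A → Bool) (g : A → A) (xs : List A) {x : A} (ys : List A) →
                  Avoids p ys → p x ≡ true → replaceLast p g (xs ++ x ∷ ys) ≡ just (xs ++ g x ∷ ys)
replaceLast-hit p g xs {x} ys ps px
  rewrite reverse-middle xs x ys
        | replaceFirst-hit p g (reverse ys) (reverse xs) (avoids-reverse ys ps) px
        | reverse-middle (reverse ys) (g x) (reverse xs)
        | reverse-involutive xs | reverse-involutive ys = refl

count-++ : (p : A → Bool) (xs ys : List A) → count p (xs ++ ys) ≡ count p xs + count p ys
count-++ p []       ys = refl
count-++ p (x ∷ xs) ys with p x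
... | true  = cong suc (count-++ p xs ys)
... | false = count-++ p xs ys

count-split : (p : A → Bool) (xs : List A) {m : ℕ} → count p xs ≡ suc m →
              ∃[ ys ] ∃[ x ] ∃[ zs ] xs ≡ ys ++ x ∷ zs × p x ≡ true × count p zs ≡ m
count-split p [] ()
count-split p (x ∷ xs) eq with p x in px
... | true  = [] , x , xs , refl , px , suc-injective eq
... | false with count-split p xs eq
...   | ys , y , zs , refl , py , c = x ∷ ys , y , zs , refl , py , c

first-difference : DecidableEquality A → (u v : List A) → u ≢ v →
                   length u ≢ length v ⊎
                   ∃[ p ] ∃[ x ] ∃[ y ] ∃[ u′ ] ∃[ v′ ] x ≢ y × u ≡ p ++ x ∷ u′ × v ≡ p ++ y ∷ v′
first-difference _≟ᴬ_ []      []      u≢v = inj₁ λ _ → u≢v refl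
first-difference _≟ᴬ_ []      (_ ∷ _) u≢v = inj₁ λ ()
first-difference _≟ᴬ_ (_ ∷ _) []      u≢v = inj₁ λ ()
first-difference _≟ᴬ_ (x ∷ u) (y ∷ v) u≢v with x ≟ᴬ y
... | no x≢y = inj₂ ([] , x , y , u , v , x≢y , refl , refl)
... | yes refl with first-difference _≟ᴬ_ u v (λ u≡v → u≢v (cong (x ∷_) u≡v))
...   | inj₁ |u|≢|v| = inj₁ λ eq → |u|≢|v| (suc-injective eq)
...   | inj₂ (p , x′ , y′ , u′ , v′ , x′≢y′ , refl , refl) =
        inj₂ (x ∷ p , x′ , y′ , u′ , v′ , x′≢y′ , refl , refl)

substWord-singletons : ∀ {n m} (f : Fin m → Letter n) (w : List (Fin m)) →
                       substWord (λ z → [ f z ]) w ≡ map f w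
substWord-singletons f w = sym (trans (sym (concatMap-pure (map f w))) (concatMap-map [_] f w))

-- Crystal operators on inversion-free words

hasInv-false : ∀ {n} (i : Fin n) (w₁ w₂ : Word n) →
               Avoids (isX i) w₁ → Avoids (isY i) w₂ → hasInv i (w₁ ++ w₂) ≡ false
hasInv-false i []       []       _  _ = refl
hasInv-false i []       (a ∷ w₂) [] (ya ∷ yw)
  rewrite any-avoids (isY i) w₂ yw | ∧-zeroʳ (isX i a) = hasInv-false i [] w₂ [] yw
hasInv-false i (a ∷ w₁) w₂ (xa ∷ xw) yw rewrite xa = hasInv-false i w₁ w₂ xw yw

hasInv-true : ∀ {n} (i : Fin n) (w₁ : Word n) {a : Letter n} (w₂ : Word n) →
              isX i a ≡ true → any (isY i) w₂ ≡ true → hasInv i (w₁ ++ a ∷ w₂) ≡ true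
hasInv-true i []       w₂ xa yw rewrite xa | yw = refl
hasInv-true i (b ∷ w₁) {a} w₂ xa yw rewrite hasInv-true i w₁ {a} w₂ xa yw = ∨-zeroʳ _

module _ {n : ℕ} (i : Fin n) (w : Word n) where

  ε̈-inversion : hasInv i w ≡ true → ε̈ i w ≡ ∞
  ε̈-inversion inv rewrite inv = refl

  ε̈-no-inversion : hasInv i w ≡ false → ε̈ i w ≡ fin (count (isY i) w)
  ε̈-no-inversion inv rewrite inv = refl

  ë-no-inversion : hasInv i w ≡ false → ë i w ≡ replaceLast (isY i) eImg w
  ë-no-inversion inv rewrite inv = refl

  f̈-no-inversion : hasInv i w ≡ false → f̈ i w ≡ replaceFirst (isX i) fImg w
  f̈-no-inversion inv rewrite inv = refl

ë-last : ∀ {n} (i : Fin n) (w₁ : Word n) {a : Letter n} (w₂ : Word n) →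
         Avoids (isX i) w₁ → isX i a ≡ false → isY i a ≡ true → Avoids (isY i) w₂ →
         ë i (w₁ ++ a ∷ w₂) ≡ just (w₁ ++ eImg a ∷ w₂)
ë-last i w₁ {a} w₂ xw₁ xa ya yw₂ = begin
  ë i (w₁ ++ a ∷ w₂)                   ≡⟨ ë-no-inversion i (w₁ ++ a ∷ w₂) no-inversion ⟩
  replaceLast (isY i) eImg (w₁ ++ a ∷ w₂) ≡⟨ replaceLast-hit (isY i) eImg w₁ w₂ yw₂ ya ⟩
  just (w₁ ++ eImg a ∷ w₂)             ∎
  where
  no-inversion : hasInv i (w₁ ++ a ∷ w₂) ≡ false
  no-inversion = subst (λ w → hasInv i w ≡ false) (∷ʳ-++ w₁ a w₂)
                   (hasInv-false i (w₁ ∷ʳ a) w₂ (++⁺ xw₁ (xa ∷ [])) yw₂)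

f̈-first : ∀ {n} (i : Fin n) (w₁ : Word n) {a : Letter n} (w₂ : Word n) →
          Avoids (isX i) w₁ → isX i a ≡ true → isY i a ≡ false → Avoids (isY i) w₂ →
          f̈ i (w₁ ++ a ∷ w₂) ≡ just (w₁ ++ fImg a ∷ w₂)
f̈-first i w₁ {a} w₂ xw₁ xa ya yw₂ =
  trans (f̈-no-inversion i (w₁ ++ a ∷ w₂) (hasInv-false i w₁ (a ∷ w₂) xw₁ (ya ∷ yw₂)))
        (replaceFirst-hit (isX i) fImg w₁ w₂ xw₁ xa)

-- Paths of crystal operators

data Op (n : ℕ) : Set where
  E F : Fin n → Op n

act : ∀ {n} → Op n → Word n → Maybe (Word n)
act (E i) = ë i
act (F i) = f̈ i

run : ∀ {n} → List (Op n) → Word n → Maybe (Word n)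
run []       w = just w
run (o ∷ os) w = act o w >>= run os

run-++ : ∀ {n} (os : List (Op n)) {os′ : List (Op n)} {w w₁ w₂ : Word n} →
         run os w ≡ just w₁ → run os′ w₁ ≡ just w₂ → run (os ++ os′) w ≡ just w₂
run-++ []           refl h′ = h′
run-++ (o ∷ os) {w = w} h h′ with act o w
... | just w′ = run-++ os h h′

run-replicate-suc : ∀ {n} (o : Op n) (m : ℕ) (w : Word n) →
                    run (replicate (suc m) o) w ≡ (run (replicate m o) w >>= act o)
run-replicate-suc o zero w with act o w
... | just _  = refl
... | nothing = refl
run-replicate-suc o (suc m) w with act o w
... | just w′ = run-replicate-suc o m w′
... | nothing = refl

run-subst : ∀ {n} (os : List (Op n)) {w₀ w w₀′ w′ : Word n} →
            w₀ ≡ w → w₀′ ≡ w′ → run os w₀ ≡ just w₀′ → run os w ≡ just w′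
run-subst os refl refl h = h

reach-act : ∀ {n} {u x y : Word n} (o : Op n) → Reach u x → act o x ≡ just y → Reach u y
reach-act (E i) = stepE i
reach-act (F i) = stepF i

reach-run : ∀ {n} {u : Word n} (ψ : Word n → Word n) →
            (∀ {x} → Reach u x → ∀ o → Maybe.map ψ (act o x) ≡ act o (ψ x)) →
            ∀ os {x y} → Reach u x → run os x ≡ just y → Reach u y × run os (ψ x) ≡ just (ψ y)
reach-run ψ act-ψ []       r refl = r , refl
reach-run ψ act-ψ (o ∷ os) {x} r eq with act o x in ax
... | just x′ with reach-run ψ act-ψ os (reach-act o r ax) eq
...   | r′ , ψ-run = r′ , (begin
  (act o (ψ x) >>= run os)            ≡⟨ cong (_>>= run os) (sym (act-ψ r o)) ⟩
  (Maybe.map ψ (act o x) >>= run os)  ≡⟨ cong (λ m → Maybe.map ψ m >>= run os) ax ⟩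
  run os (ψ x′)                       ≡⟨ ψ-run ⟩
  just (ψ _)                          ∎)

HypoEq-wt : ∀ {n} {u v : Word n} → HypoEq u v → ∀ j → wt v j ≡ wt u j
HypoEq-wt (ψ , refl , _ , _ , _ , compat) j = proj₁ (compat _ here) j

HypoEq-ε̈-along : ∀ {n} {u v u′ v′ : Word n} → HypoEq u v → ∀ os →
                 run os u ≡ just u′ → run os v ≡ just v′ → ∀ i → ε̈ i v′ ≡ ε̈ i u′
HypoEq-ε̈-along {u = u} {u′ = u′} {v′} (ψ , refl , _ , _ , _ , compat) os ru rv i =
  begin
    ε̈ i v′      ≡⟨ cong (ε̈ i) (just-injective (trans (sym rv) ψ-run)) ⟩
    ε̈ i (ψ u′)  ≡⟨ ε̈-preserved ⟩
    ε̈ i u′      ∎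
  where
  act-ψ : ∀ {x} → Reach u x → ∀ o → Maybe.map ψ (act o x) ≡ act o (ψ x)
  act-ψ r (E j) with compat _ r
  ... | _ , _ , _ , ë-ψ , _ = ë-ψ j
  act-ψ r (F j) with compat _ r
  ... | _ , _ , _ , _ , f̈-ψ = f̈-ψ j
  r : Reach u u′
  r = proj₁ (reach-run ψ act-ψ os here ru)
  ψ-run : run os (ψ u) ≡ just (ψ u′)
  ψ-run = proj₂ (reach-run ψ act-ψ os here ru)
  ε̈-preserved : ε̈ i (ψ u′) ≡ ε̈ i u′
  ε̈-preserved with compat u′ r
  ... | _ , ε̈-ψ , _ = ε̈-ψ i

-- The separating words, for n = 3 + k

module Witness (k : ℕ) where

  N : ℕ
  N = suc (suc (suc k))

  i₁ i₂ : Fin N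
  i₁ = zero
  i₂ = suc zero

  -- enc: true ↦ 1, false ↦ bar 2;  enc₁: 2, bar 1 (its image under f̈₁);  enc₂: 1, bar 3.
  enc enc₁ enc₂ : Bool → Letter N
  enc true  = pos zero
  enc false = neg (suc zero)
  enc₁ c = fImg (enc c)
  enc₂ true  = pos zero
  enc₂ false = neg (suc (suc zero))

  wt₂-enc : ∀ X → wt (map enc X) i₂ ≡ - + count not X
  wt₂-enc X = begin
    + count (isPos i₂) (map enc X) - + count (isNeg i₂) (map enc X) ≡⟨ cong₂ (λ a b → + a - + b) (no-2 X) (bar-2s X) ⟩
    + 0 - + count not X                                              ≡⟨ ℤ.+-identityˡ _ ⟩
    - + count not X                                                  ∎
    where
    no-2 : ∀ X → count (isPos i₂) (map enc X) ≡ 0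
    no-2 []          = refl
    no-2 (true ∷ X)  = no-2 X
    no-2 (false ∷ X) = no-2 X
    bar-2s : ∀ X → count (isNeg i₂) (map enc X) ≡ count not X
    bar-2s []          = refl
    bar-2s (true ∷ X)  = bar-2s X
    bar-2s (false ∷ X) = cong suc (bar-2s X)

  HypoEq-enc⇒count-not≡ : ∀ X Y → HypoEq (map enc X) (map enc Y) → count not X ≡ count not Y
  HypoEq-enc⇒count-not≡ X Y H = sym (ℤ.+-injective (ℤ.neg-injective (begin
    - + count not Y     ≡⟨ sym (wt₂-enc Y) ⟩
    wt (map enc Y) i₂   ≡⟨ HypoEq-wt H i₂ ⟩
    wt (map enc X) i₂   ≡⟨ wt₂-enc X ⟩
    - + count not X     ∎)))

  ë₂-phase : ∀ Y W → Avoids (isX i₂) Y →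
             run (replicate (count not W) (E i₂)) (Y ++ map enc W) ≡ just (Y ++ map enc₂ W)
  ë₂-phase Y []          _  = refl
  ë₂-phase Y (true ∷ W)  xY = run-subst (replicate (count not W) (E i₂)) (∷ʳ-++ Y _ _) (∷ʳ-++ Y _ _)
    (ë₂-phase (Y ∷ʳ enc true) W (++⁺ xY (refl ∷ [])))
  ë₂-phase Y (false ∷ W) xY = begin
    run (replicate (suc m) (E i₂)) (Y ++ enc false ∷ map enc W)       ≡⟨ run-replicate-suc (E i₂) m _ ⟩
    (run (replicate m (E i₂)) (Y ++ enc false ∷ map enc W) >>= ë i₂)  ≡⟨ cong (_>>= ë i₂) earlier ⟩
    ë i₂ (Y ++ enc false ∷ map enc₂ W)                                ≡⟨ ë-last i₂ Y _ xY refl refl (avoids-map-Bool refl refl W) ⟩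
    just (Y ++ enc₂ false ∷ map enc₂ W)                               ∎
    where
    m : ℕ
    m = count not W
    earlier : run (replicate m (E i₂)) (Y ++ enc false ∷ map enc W) ≡ just (Y ++ enc false ∷ map enc₂ W)
    earlier = run-subst (replicate m (E i₂)) (∷ʳ-++ Y _ _) (∷ʳ-++ Y _ _)
      (ë₂-phase (Y ∷ʳ enc false) W (++⁺ xY (refl ∷ [])))

  f̈₁-step : ∀ C c R → Avoids (isY i₁) R → f̈ i₁ (map enc₁ C ++ enc c ∷ R) ≡ just (map enc₁ C ++ enc₁ c ∷ R)
  f̈₁-step C true  R yR = f̈-first i₁ (map enc₁ C) R (avoids-map-Bool refl refl C) refl refl yR
  f̈₁-step C false R yR = f̈-first i₁ (map enc₁ C) R (avoids-map-Bool refl refl C) refl refl yR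

  f̈₁-phase : ∀ C Q c R → Avoids (isY i₁) (enc c ∷ R) →
             run (replicate (suc (length Q)) (F i₁)) (map enc₁ C ++ map enc Q ++ enc c ∷ R)
               ≡ just (map enc₁ C ++ map enc₁ Q ++ enc₁ c ∷ R)
  f̈₁-phase C []      c R (_ ∷ yR) = cong (_>>= just) (f̈₁-step C c R yR)
  f̈₁-phase C (q ∷ Q) c R yR = begin
    (f̈ i₁ (map enc₁ C ++ enc q ∷ map enc Q ++ enc c ∷ R) >>= run fs)  ≡⟨ cong (_>>= run fs) (f̈₁-step C q _ yQR) ⟩
    run fs (map enc₁ C ++ enc₁ q ∷ map enc Q ++ enc c ∷ R)            ≡⟨ later ⟩
    just (map enc₁ C ++ enc₁ q ∷ map enc₁ Q ++ enc₁ c ∷ R)            ∎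
    where
    fs : List (Op N)
    fs = replicate (suc (length Q)) (F i₁)
    yQR : Avoids (isY i₁) (map enc Q ++ enc c ∷ R)
    yQR = ++⁺ (avoids-map-Bool refl refl Q) yR
    later : run fs (map enc₁ C ++ enc₁ q ∷ map enc Q ++ enc c ∷ R) ≡ just (map enc₁ C ++ enc₁ q ∷ map enc₁ Q ++ enc₁ c ∷ R)
    later = run-subst fs (map-∷ʳ-++ enc₁ C q _) (map-∷ʳ-++ enc₁ C q _) (f̈₁-phase (C ∷ʳ q) Q c R yR)

  separating-path : List Bool → List Bool → List (Op N)
  separating-path P V = replicate (count not V) (E i₂) ++ replicate (suc (length P)) (F i₁)

  separating-path-∞ : ∀ P U₁ U₂ V → count not U₂ ≡ count not V →
    ∃[ s ] run (separating-path P V) (map enc P ++ enc true ∷ map enc U₁ ++ enc false ∷ map enc U₂) ≡ just s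
           × ε̈ i₂ s ≡ ∞
  separating-path-∞ P U₁ U₂ V balanced = s₂ , run-++ (replicate (count not V) (E i₂)) ë-part f̈-part , ε̈-inversion i₂ s₂ inversion
    where
    σP σU₁ s₀ s₁ s₂ : Word N
    σP  = map enc P
    σU₁ = map enc U₁
    s₀ = σP ++ enc true ∷ σU₁ ++ enc false ∷ map enc U₂
    s₁ = σP ++ enc true ∷ σU₁ ++ enc false ∷ map enc₂ U₂
    s₂ = map enc₁ P ++ enc₁ true ∷ σU₁ ++ enc false ∷ map enc₂ U₂
    ë-part : run (replicate (count not V) (E i₂)) s₀ ≡ just s₁
    ë-part = subst (λ m → run (replicate m (E i₂)) s₀ ≡ just s₁) balanced
      (run-subst (replicate (count not U₂) (E i₂)) (++-∷-∷ʳ σP _ σU₁ _ _) (++-∷-∷ʳ σP _ σU₁ _ _)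
        (ë₂-phase (σP ++ enc true ∷ σU₁ ∷ʳ enc false) U₂
          (++⁺ (avoids-map-Bool refl refl P) (refl ∷ ++⁺ (avoids-map-Bool refl refl U₁) (refl ∷ [])))))
    f̈-part : run (replicate (suc (length P)) (F i₁)) s₁ ≡ just s₂
    f̈-part = f̈₁-phase [] P true (σU₁ ++ enc false ∷ map enc₂ U₂)
      (refl ∷ ++⁺ (avoids-map-Bool refl refl U₁) (refl ∷ avoids-map-Bool refl refl U₂))
    inversion : hasInv i₂ s₂ ≡ true
    inversion = hasInv-true i₂ (map enc₁ P) _ refl (any-hit (isY i₂) σU₁ _ refl)

  separating-path-fin : ∀ P V →
    ∃[ t ] run (separating-path P V) (map enc P ++ enc false ∷ map enc V) ≡ just t
           × ε̈ i₂ t ≡ fin (count (isY i₂) t)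
  separating-path-fin P V = t₂ , run-++ (replicate (count not V) (E i₂)) ë-part f̈-part , ε̈-no-inversion i₂ t₂ no-inversion
    where
    t₀ t₁ t₂ : Word N
    t₀ = map enc P ++ enc false ∷ map enc V
    t₁ = map enc P ++ enc false ∷ map enc₂ V
    t₂ = map enc₁ P ++ enc₁ false ∷ map enc₂ V
    ë-part : run (replicate (count not V) (E i₂)) t₀ ≡ just t₁
    ë-part = run-subst (replicate (count not V) (E i₂)) (∷ʳ-++ (map enc P) _ _) (∷ʳ-++ (map enc P) _ _)
      (ë₂-phase (map enc P ∷ʳ enc false) V (++⁺ (avoids-map-Bool refl refl P) (refl ∷ [])))
    f̈-part : run (replicate (suc (length P)) (F i₁)) t₁ ≡ just t₂
    f̈-part = f̈₁-phase [] P false (map enc₂ V) (refl ∷ avoids-map-Bool refl refl V)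
    no-inversion : hasInv i₂ t₂ ≡ false
    no-inversion = hasInv-false i₂ [] t₂ []
      (++⁺ (avoids-map-Bool refl refl P) (refl ∷ avoids-map-Bool refl refl V))

  separated : ∀ P U₁ U₂ V → count not U₂ ≡ count not V →
              ¬ HypoEq (map enc P ++ enc true ∷ map enc U₁ ++ enc false ∷ map enc U₂)
                       (map enc P ++ enc false ∷ map enc V)
  separated P U₁ U₂ V balanced H
    with separating-path-∞ P U₁ U₂ V balanced | separating-path-fin P V
  ... | s , s-run , εs≡∞ | t , t-run , εt≡fin = fin≢∞ (begin
    fin (count (isY i₂) t)  ≡⟨ sym εt≡fin ⟩
    ε̈ i₂ t                  ≡⟨ HypoEq-ε̈-along H (separating-path P V) s-run t-run i₂ ⟩
    ε̈ i₂ s                  ≡⟨ εs≡∞ ⟩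
    ∞                       ∎)
    where
    fin≢∞ : ∀ {c} → fin c ≢ ∞
    fin≢∞ ()

  no-HypoEq : ∀ P U V → ¬ HypoEq (map enc (P ++ true ∷ U)) (map enc (P ++ false ∷ V))
  no-HypoEq P U V H with count-split not U one-more-bar-2
    where
    one-more-bar-2 : count not U ≡ suc (count not V)
    one-more-bar-2 = +-cancelˡ-≡ (count not P) _ _ (begin
      count not P + count not U        ≡⟨ sym (count-++ not P (true ∷ U)) ⟩
      count not (P ++ true ∷ U)        ≡⟨ HypoEq-enc⇒count-not≡ _ _ H ⟩
      count not (P ++ false ∷ V)       ≡⟨ count-++ not P (false ∷ V) ⟩
      count not P + suc (count not V)  ∎)
  ... | U₁ , false , U₂ , refl , _ , balanced =
    separated P U₁ U₂ V balanced (subst₂ HypoEq s-shape (map-++ enc P (false ∷ V)) H)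
    where
    s-shape : map enc (P ++ true ∷ U₁ ++ false ∷ U₂) ≡ map enc P ++ enc true ∷ map enc U₁ ++ enc false ∷ map enc U₂
    s-shape = trans (map-++ enc P _) (cong (λ w → map enc P ++ enc true ∷ w) (map-++ enc U₁ (false ∷ U₂)))

  Satisfies⇒HypoEq-enc : ∀ {m} {u v : List (Fin m)} (f : Fin m → Bool) →
                         Satisfies N m u v → HypoEq (map enc (map f u)) (map enc (map f v))
  Satisfies⇒HypoEq-enc {u = u} {v} f sat = subst₂ HypoEq (image u) (image v) (sat λ z → [ enc (f z) ])
    where
    image : ∀ w → substWord (λ z → [ enc (f z) ]) w ≡ map enc (map f w)
    image w = trans (substWord-singletons (λ z → enc (f z)) w) (map-∘ w)

  Satisfies⇒length≡ : ∀ {m} (u v : List (Fin m)) → Satisfies N m u v → length u ≡ length v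
  Satisfies⇒length≡ u v sat = begin
    length u                          ≡⟨ sym (count-bar-2s u) ⟩
    count not (map (λ _ → false) u)   ≡⟨ HypoEq-enc⇒count-not≡ _ _ (Satisfies⇒HypoEq-enc {u = u} {v} (λ _ → false) sat) ⟩
    count not (map (λ _ → false) v)   ≡⟨ count-bar-2s v ⟩
    length v                          ∎
    where
    count-bar-2s : ∀ {m} (w : List (Fin m)) → count not (map (λ _ → false) w) ≡ length w
    count-bar-2s []      = refl
    count-bar-2s (_ ∷ w) = cong suc (count-bar-2s w)

  Satisfies⇒same-letter : ∀ {m} (p : List (Fin m)) {x y : Fin m} (u′ v′ : List (Fin m)) →
                          x ≢ y → ¬ Satisfies N m (p ++ x ∷ u′) (p ++ y ∷ v′)
  Satisfies⇒same-letter p {x} {y} u′ v′ x≢y sat =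
    no-HypoEq (map is-x p) (map is-x u′) (map is-x v′)
      (subst₂ HypoEq (cong (map enc) (shape (dec-true (x ≟ x) refl) u′))
                     (cong (map enc) (shape (dec-false (y ≟ x) (λ y≡x → x≢y (sym y≡x))) v′))
        (Satisfies⇒HypoEq-enc is-x sat))
    where
    is-x : Fin _ → Bool
    is-x z = does (z ≟ x)
    shape : ∀ {z c} → is-x z ≡ c → ∀ w → map is-x (p ++ z ∷ w) ≡ map is-x p ++ c ∷ map is-x w
    shape refl w = map-++ is-x p (_ ∷ w)

corollary9p35 : (n : ℕ) → 3 ≤ n →
    (m : ℕ) (u v : List (Fin m)) → u ≢ v → ¬ Satisfies n m u v
corollary9p35 (suc (suc (suc k))) (s≤s (s≤s (s≤s _))) m u v u≢v sat with first-difference _≟_ u v u≢v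
... | inj₁ |u|≢|v| = |u|≢|v| (Witness.Satisfies⇒length≡ k u v sat)
... | inj₂ (p , x , y , u′ , v′ , x≢y , refl , refl) = Witness.Satisfies⇒same-letter k p u′ v′ x≢y sat
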